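{- For every positive integer $m$, there is a graph $G$ with $\mathrm{bc}(G)=m$ and $\mathrm{bp}(G)=\frac{1}{2}(3^m-1)$.
   Context: A biclique of a graph $G$ is a complete bipartite subgraph of $G$. A biclique cover of $G$ is a collection of bicliques of $G$ the union of whose edge sets is $E(G)$; a biclique partition is a collection of bicliques of $G$ whose edge sets partition $E(G)$. $\mathrm{bc}(G)$ is the least number of bicliques in a biclique cover of $G$, and $\mathrm{bp}(G)$ is the least number of bicliques in a biclique partition of $G$. -}

module Defs where

open import Level using (0ℓ)
open import Data.Nat using (ℕ; _≤_)
open import Data.Fin using (Fin)
open import Data.Fin.Subset using (Subset; _∈_; Nonempty)
open import Data.Product using (Σ; ∃; _×_; _,_)
open import Data.Sum using (_⊎_)
open import Data.Empty using (⊥)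
open import Relation.Nullary using (¬_; Dec)
open import Relation.Binary.PropositionalEquality using (_≡_)

record Graph : Set₁ where
  field
    n     : ℕ
    Adj   : Fin n → Fin n → Set
    adj?  : ∀ u v → Dec (Adj u v)
    sym   : ∀ {u v} → Adj u v → Adj v u
    irrefl : ∀ {u} → ¬ Adj u u

open Graph public

record Biclique (G : Graph) : Set where
  field
    partA    : Subset (n G)
    partB    : Subset (n G)
    nonemptyA : Nonempty partA
    nonemptyB : Nonempty partB
    disjoint : ∀ v → v ∈ partA → v ∈ partB → ⊥
    complete : ∀ a b → a ∈ partA → b ∈ partB → Adj G a b

open Biclique public

EdgeIn : {G : Graph} → Biclique G → Fin (n G) → Fin (n G) → Set
EdgeIn H u v = (u ∈ partA H × v ∈ partB H) ⊎ (v ∈ partA H × u ∈ partB H)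

IsBicliqueCover : (G : Graph) (k : ℕ) → (Fin k → Biclique G) → Set
IsBicliqueCover G k Hs = ∀ u v → Adj G u v → ∃ λ i → EdgeIn (Hs i) u v

IsBicliquePartition : (G : Graph) (k : ℕ) → (Fin k → Biclique G) → Set
IsBicliquePartition G k Hs =
  IsBicliqueCover G k Hs ×
  (∀ u v → Adj G u v → ∀ i j → EdgeIn (Hs i) u v → EdgeIn (Hs j) u v → i ≡ j)

bcIs : Graph → ℕ → Set
bcIs G m = (Σ (Fin m → Biclique G) (IsBicliqueCover G m))
         × (∀ k (Hs : Fin k → Biclique G) → IsBicliqueCover G k Hs → m ≤ k)

bpIs : Graph → ℕ → Set
bpIs G p = (Σ (Fin p → Biclique G) (IsBicliquePartition G p))
         × (∀ k (Hs : Fin k → Biclique G) → IsBicliquePartition G k Hs → p ≤ k)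

module Submission where

-- G m is the graph on the words of length m over {0, 1, 2}, two words being
-- adjacent if some position carries 0 in one of them and 1 in the other.
-- bc(G m) = m: the m "position" bicliques (letter 0 versus letter 1 at position
-- i) cover G m by definition, and the edges between the spikes (0 resp. 1 at
-- position i, 2 elsewhere) form a fooling set of size m.
-- bp(G m) = (3 ^ m - 1) / 2: an explicit recursive partition has that many parts
-- (one biclique for the first letter, three lifts of each part of G (m - 1)),
-- and by an inertia argument none is smaller: if the form of J - A (non-adjacency)
-- is negative definite on a d-dimensional span, a partition into k < d parts
-- yields a nonzero z there with zᵀ A z = 0, so (∑ z)² = zᵀ (J - A) z < 0. Here
-- J - A is a Kronecker power of a 3 × 3 matrix of signature (2, 1), giving d =
-- (3 ^ m - 1) / 2. The general tools come first (sums and forms over ℤ, linear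
-- systems, the inertia and fooling-set bounds), then G m and the theorem.

module BilinearForms where

  open import Data.Nat as ℕ using (ℕ; zero; suc)
  open import Data.Fin using (Fin; zero; suc; _↑ˡ_; _↑ʳ_; splitAt; punchIn; combine; quotient; remainder)
  open import Data.Fin.Properties using (punchInᵢ≢i; remQuot-combine; splitAt⁻¹-↑ˡ; splitAt⁻¹-↑ʳ)
  open import Data.Vec.Functional using (Vector; _++_)
  open import Data.Product using (proj₁; proj₂)
  open import Data.Sum using (inj₁; inj₂)
  open import Data.Integer using (ℤ; 0ℤ; 1ℤ; _+_; _*_)
  import Data.Integer.Properties as ℤ
  open import Relation.Binary.PropositionalEquality
  open import Data.Integer.Tactic.RingSolver using (solve-∀)
  open import Algebra.Properties.Semiring.Sum ℤ.+-*-semiring public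
    using (sum; sum-syntax; sum-cong-≗; ∑-comm; *-distribˡ-sum; *-distribʳ-sum; ∑-distrib-+)
  open import Algebra.Properties.Semiring.Sum ℤ.+-*-semiring
    using (sum-remove; sum-replicate-zero)

  ∑-++ : ∀ m {n} (f : Vector ℤ (m ℕ.+ n)) →
         sum f ≡ ∑[ i < m ] f (i ↑ˡ n) + ∑[ j < n ] f (m ↑ʳ j)
  ∑-++ zero    f = sym (ℤ.+-identityˡ _)
  ∑-++ (suc m) f = trans (cong (f zero +_) (∑-++ m (λ i → f (suc i))))
                         (sym (ℤ.+-assoc (f zero) _ _))

  ∑-combine : ∀ m {n} (f : Vector ℤ (m ℕ.* n)) →
              sum f ≡ ∑[ a < m ] ∑[ x < n ] f (combine a x)
  ∑-combine zero    f = refl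
  ∑-combine (suc m) {n} f =
    trans (∑-++ n f) (cong (∑[ x < n ] f (x ↑ˡ m ℕ.* n) +_) (∑-combine m (λ u → f (n ↑ʳ u))))

  ∑-single : ∀ {n} (f : Vector ℤ n) i → (∀ j → j ≢ i → f j ≡ 0ℤ) → sum f ≡ f i
  ∑-single {suc n} f i vanish = begin
    sum f                              ≡⟨ sum-remove {i = i} f ⟩
    f i + (∑[ j < n ] f (punchIn i j)) ≡⟨ cong (f i +_) (sum-cong-≗ λ j → vanish _ (punchInᵢ≢i i j)) ⟩
    f i + (∑[ j < n ] 0ℤ)              ≡⟨ cong (f i +_) (sum-replicate-zero n) ⟩
    f i + 0ℤ                           ≡⟨ ℤ.+-identityʳ (f i) ⟩
    f i                                ∎
    where open ≡-Reasoning

  ∑-product : ∀ {m n} (f : Vector ℤ m) (g : Vector ℤ n) →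
              sum f * sum g ≡ ∑[ i < m ] ∑[ j < n ] (f i * g j)
  ∑-product f g = trans (*-distribʳ-sum (sum g) f) (sum-cong-≗ λ i → *-distribˡ-sum (f i) g)

  Matrix : ℕ → Set
  Matrix n = Fin n → Fin n → ℤ

  _·_ : ∀ {n} → Vector ℤ n → Vector ℤ n → ℤ
  _·_ {n} x y = ∑[ u < n ] (x u * y u)

  𝟙 : ∀ {n} → Vector ℤ n
  𝟙 _ = 1ℤ

  form : ∀ {n} → Matrix n → Vector ℤ n → Vector ℤ n → ℤ
  form {n} N x y = ∑[ u < n ] ∑[ v < n ] (N u v * (x u * y v))

  combination : ∀ {d n} → Vector ℤ d → (Fin d → Vector ℤ n) → Vector ℤ n
  combination {d} c E u = ∑[ j < d ] (c j * E j u)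

  form-cong : ∀ {n} {N N′ : Matrix n} → (∀ u v → N u v ≡ N′ u v) →
              ∀ x y → form N x y ≡ form N′ x y
  form-cong N≡N′ x y = sum-cong-≗ λ u → sum-cong-≗ λ v → cong (_* (x u * y v)) (N≡N′ u v)

  form-+ : ∀ {n} (N N′ : Matrix n) x y →
           form (λ u v → N u v + N′ u v) x y ≡ form N x y + form N′ x y
  form-+ N N′ x y = begin
    form (λ u v → N u v + N′ u v) x y
      ≡⟨ sum-cong-≗ (λ u → sum-cong-≗ λ v → ℤ.*-distribʳ-+ (x u * y v) (N u v) (N′ u v)) ⟩
    ∑[ u < _ ] ∑[ v < _ ] (N u v * (x u * y v) + N′ u v * (x u * y v))
      ≡⟨ sum-cong-≗ (λ u → ∑-distrib-+ (λ v → N u v * (x u * y v)) _) ⟩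
    ∑[ u < _ ] (∑[ v < _ ] (N u v * (x u * y v)) + ∑[ v < _ ] (N′ u v * (x u * y v)))
      ≡⟨ ∑-distrib-+ (λ u → ∑[ v < _ ] (N u v * (x u * y v))) _ ⟩
    form N x y + form N′ x y ∎
    where open ≡-Reasoning

  form-∑ : ∀ {n k} (N : Fin k → Matrix n) x y →
           form (λ u v → ∑[ i < k ] N i u v) x y ≡ ∑[ i < k ] form (N i) x y
  form-∑ {n} N x y = begin
    ∑[ u < n ] ∑[ v < n ] (sum (λ i → N i u v) * (x u * y v))
      ≡⟨ sum-cong-≗ (λ u → sum-cong-≗ λ v → *-distribʳ-sum (x u * y v) (λ i → N i u v)) ⟩
    ∑[ u < n ] ∑[ v < n ] ∑[ i < _ ] (N i u v * (x u * y v))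
      ≡⟨ sum-cong-≗ (λ u → ∑-comm (λ v i → N i u v * (x u * y v))) ⟩
    ∑[ u < n ] ∑[ i < _ ] ∑[ v < n ] (N i u v * (x u * y v))
      ≡⟨ ∑-comm (λ u i → ∑[ v < n ] (N i u v * (x u * y v))) ⟩
    ∑[ i < _ ] form (N i) x y ∎
    where open ≡-Reasoning

  form-outer : ∀ {n} (a b x y : Vector ℤ n) →
               form (λ u v → a u * b v) x y ≡ (a · x) * (b · y)
  form-outer a b x y = begin
    ∑[ u < _ ] ∑[ v < _ ] (a u * b v * (x u * y v))
      ≡⟨ sum-cong-≗ (λ u → sum-cong-≗ λ v → regroup (a u) (b v) (x u) (y v)) ⟩
    ∑[ u < _ ] ∑[ v < _ ] (a u * x u * (b v * y v))
      ≡⟨ sym (∑-product (λ u → a u * x u) (λ v → b v * y v)) ⟩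
    (a · x) * (b · y) ∎
    where
    open ≡-Reasoning
    regroup : ∀ a b x y → a * b * (x * y) ≡ a * x * (b * y)
    regroup = solve-∀

  ·-combination : ∀ {d n} (a : Vector ℤ n) (c : Vector ℤ d) (E : Fin d → Vector ℤ n) →
                  a · combination c E ≡ (λ j → a · E j) · c
  ·-combination {d} {n} a c E = begin
    ∑[ u < n ] (a u * ∑[ j < d ] (c j * E j u))
      ≡⟨ sum-cong-≗ (λ u → *-distribˡ-sum (a u) (λ j → c j * E j u)) ⟩
    ∑[ u < n ] ∑[ j < d ] (a u * (c j * E j u))
      ≡⟨ ∑-comm (λ u j → a u * (c j * E j u)) ⟩
    ∑[ j < d ] ∑[ u < n ] (a u * (c j * E j u))
      ≡⟨ sum-cong-≗ (λ j → sum-cong-≗ λ u → regroup (a u) (c j) (E j u)) ⟩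
    ∑[ j < d ] ∑[ u < n ] (a u * E j u * c j)
      ≡⟨ sum-cong-≗ (λ j → sym (*-distribʳ-sum (c j) (λ u → a u * E j u))) ⟩
    (λ j → a · E j) · c ∎
    where
    open ≡-Reasoning
    regroup : ∀ a c e → a * (c * e) ≡ a * e * c
    regroup = solve-∀

  form-linearˡ : ∀ {d n} (N : Matrix n) (c : Vector ℤ d) (E : Fin d → Vector ℤ n) y →
                 form N (combination c E) y ≡ ∑[ j < d ] (c j * form N (E j) y)
  form-linearˡ {d} {n} N c E y = begin
    ∑[ u < n ] ∑[ v < n ] (N u v * (combination c E u * y v))
      ≡⟨ sum-cong-≗ (λ u → sum-cong-≗ λ v → pointwise (N u v) (y v) (λ j → E j u)) ⟩
    ∑[ u < n ] ∑[ v < n ] ∑[ j < d ] (c j * (N u v * (E j u * y v)))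
      ≡⟨ sum-cong-≗ (λ u → ∑-comm (λ v j → c j * (N u v * (E j u * y v)))) ⟩
    ∑[ u < n ] ∑[ j < d ] ∑[ v < n ] (c j * (N u v * (E j u * y v)))
      ≡⟨ ∑-comm (λ u j → ∑[ v < n ] (c j * (N u v * (E j u * y v)))) ⟩
    ∑[ j < d ] ∑[ u < n ] ∑[ v < n ] (c j * (N u v * (E j u * y v)))
      ≡⟨ sum-cong-≗ (λ j → trans
           (sum-cong-≗ λ u → sym (*-distribˡ-sum (c j) (λ v → N u v * (E j u * y v))))
           (sym (*-distribˡ-sum (c j) (λ u → ∑[ v < n ] (N u v * (E j u * y v)))))) ⟩
    ∑[ j < d ] (c j * form N (E j) y) ∎
    where
    open ≡-Reasoning
    pointwise : ∀ m w (e : Vector ℤ d) →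
                m * (∑[ j < d ] (c j * e j) * w) ≡ ∑[ j < d ] (c j * (m * (e j * w)))
    pointwise m w e = begin
      m * (∑[ j < d ] (c j * e j) * w)   ≡⟨ cong (m *_) (*-distribʳ-sum w (λ j → c j * e j)) ⟩
      m * ∑[ j < d ] (c j * e j * w)     ≡⟨ *-distribˡ-sum m (λ j → c j * e j * w) ⟩
      ∑[ j < d ] (m * (c j * e j * w))   ≡⟨ sum-cong-≗ (λ j → swap m (c j) (e j) w) ⟩
      ∑[ j < d ] (c j * (m * (e j * w))) ∎
      where
      swap : ∀ m c e w → m * (c * e * w) ≡ c * (m * (e * w))
      swap = solve-∀

  form-transpose : ∀ {n} (N : Matrix n) x y → form N x y ≡ form (λ u v → N v u) y x
  form-transpose N x y =
    trans (∑-comm (λ u v → N u v * (x u * y v)))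
          (sum-cong-≗ λ v → sum-cong-≗ λ u → cong (N u v *_) (ℤ.*-comm (x u) (y v)))

  form-linearʳ : ∀ {d n} (N : Matrix n) (c : Vector ℤ d) (E : Fin d → Vector ℤ n) x →
                 form N x (combination c E) ≡ ∑[ j < d ] (c j * form N x (E j))
  form-linearʳ N c E x =
    trans (form-transpose N x (combination c E))
          (trans (form-linearˡ (λ u v → N v u) c E x)
                 (sum-cong-≗ λ j → cong (c j *_) (sym (form-transpose N x (E j)))))

  _⊗_ : ∀ {m n} → Matrix m → Matrix n → Matrix (m ℕ.* n)
  _⊗_ {m} {n} M N u v =
    M (quotient {m} n u) (quotient {m} n v) * N (remainder {m} n u) (remainder {m} n v)

  _⊗ᵥ_ : ∀ {m n} → Vector ℤ m → Vector ℤ n → Vector ℤ (m ℕ.* n)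
  _⊗ᵥ_ {m} {n} α φ u = α (quotient {m} n u) * φ (remainder {m} n u)

  form-⊗ : ∀ {m n} (M : Matrix m) (N : Matrix n) α β φ ψ →
           form (M ⊗ N) (α ⊗ᵥ φ) (β ⊗ᵥ ψ) ≡ form M α β * form N φ ψ
  form-⊗ {m} {n} M N α β φ ψ = begin
    form (M ⊗ N) (α ⊗ᵥ φ) (β ⊗ᵥ ψ)
      ≡⟨ ∑-combine m {n} (λ u → ∑[ v < m ℕ.* n ] T u v) ⟩
    ∑[ a < m ] ∑[ x < n ] ∑[ v < m ℕ.* n ] T (combine a x) v
      ≡⟨ sum-cong-≗ (λ a → sum-cong-≗ λ x → ∑-combine m {n} (T (combine {m} a x))) ⟩
    ∑[ a < m ] ∑[ x < n ] ∑[ b < m ] ∑[ y < n ] T (combine a x) (combine b y)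
      ≡⟨ sum-cong-≗ (λ a → sum-cong-≗ λ x → sum-cong-≗ λ b → sum-cong-≗ λ y →
           separate a x b y) ⟩
    ∑[ a < m ] ∑[ x < n ] ∑[ b < m ] ∑[ y < n ] (F a b * G x y)
      ≡⟨ sym (sum-cong-≗ λ a → sum-cong-≗ λ x → ∑-product (F a) (G x)) ⟩
    ∑[ a < m ] ∑[ x < n ] (sum (F a) * sum (G x))
      ≡⟨ sym (∑-product (λ a → sum (F a)) (λ x → sum (G x))) ⟩
    form M α β * form N φ ψ ∎
    where
    open ≡-Reasoning
    T : Matrix (m ℕ.* n)
    T u v = (M ⊗ N) u v * ((α ⊗ᵥ φ) u * (β ⊗ᵥ ψ) v)
    F : Matrix m
    F a b = M a b * (α a * β b)
    G : Matrix n
    G x y = N x y * (φ x * ψ y)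
    regroup : ∀ M N α φ β ψ → M * N * (α * φ * (β * ψ)) ≡ M * (α * β) * (N * (φ * ψ))
    regroup = solve-∀
    separate : ∀ (a : Fin m) (x : Fin n) (b : Fin m) (y : Fin n) → T (combine a x) (combine b y) ≡ F a b * G x y
    separate a x b y =
      trans (cong₂ (λ p q → M (proj₁ p) (proj₁ q) * N (proj₂ p) (proj₂ q) *
                             (α (proj₁ p) * φ (proj₂ p) * (β (proj₁ q) * ψ (proj₂ q))))
                   (remQuot-combine {m} {n} a x) (remQuot-combine {m} {n} b y))
            (regroup (M a b) (N x y) (α a) (φ x) (β b) (ψ y))

  -- A family of d vectors, pairwise orthogonal for the form of N, each of
  -- "squared length" σ. For σ = -1 it spans a subspace on which the form is
  -- negative definite (see form-span).
  record SignedFamily {n} (N : Matrix n) (σ : ℤ) (d : ℕ) : Set where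
    field
      vec  : Fin d → Vector ℤ n
      norm : ∀ j → form N (vec j) (vec j) ≡ σ
      orth : ∀ {i j} → i ≢ j → form N (vec i) (vec j) ≡ 0ℤ

  form-span : ∀ {n d σ} {N : Matrix n} (F : SignedFamily N σ d) (c : Vector ℤ d) →
              let z = combination c (SignedFamily.vec F) in
              form N z z ≡ σ * ∑[ j < d ] (c j * c j)
  form-span {n} {d} {σ} {N} F c = begin
    form N z z
      ≡⟨ form-linearˡ N c vec z ⟩
    ∑[ i < d ] (c i * form N (vec i) z)
      ≡⟨ sum-cong-≗ (λ i → cong (c i *_) (trans (form-linearʳ N c vec (vec i)) (diagonal i))) ⟩
    ∑[ i < d ] (c i * (c i * σ))
      ≡⟨ sum-cong-≗ (λ i → regroup (c i) σ) ⟩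
    ∑[ i < d ] (σ * (c i * c i))
      ≡⟨ sym (*-distribˡ-sum σ (λ i → c i * c i)) ⟩
    σ * ∑[ j < d ] (c j * c j) ∎
    where
    open ≡-Reasoning
    open SignedFamily F
    z = combination c vec
    regroup : ∀ c σ → c * (c * σ) ≡ σ * (c * c)
    regroup = solve-∀
    -- only the diagonal term survives in form N (vec i) z
    diagonal : ∀ i → ∑[ j < d ] (c j * form N (vec i) (vec j)) ≡ c i * σ
    diagonal i = trans (∑-single (λ j → c j * form N (vec i) (vec j)) i
                         (λ j j≢i → trans (cong (c j *_) (orth (λ i≡j → j≢i (sym i≡j))))
                                          (ℤ.*-zeroʳ (c j))))
                       (cong (c i *_) (norm i))

  reindex : ∀ {n σ d} {N N′ : Matrix n} → (∀ u v → N u v ≡ N′ u v) →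
            SignedFamily N σ d → SignedFamily N′ σ d
  reindex N≡N′ F = record
    { vec  = vec
    ; norm = λ j → trans (sym (form-cong N≡N′ (vec j) (vec j))) (norm j)
    ; orth = λ {i} {j} i≢j → trans (sym (form-cong N≡N′ (vec i) (vec j))) (orth i≢j)
    }
    where open SignedFamily F

  ++-all : ∀ {a p} {A : Set a} {P : A → Set p} {m n} {f : Vector A m} {g : Vector A n} →
           (∀ i → P (f i)) → (∀ j → P (g j)) → ∀ k → P ((f ++ g) k)
  ++-all {m = m} Pf Pg k with splitAt m k
  ... | inj₁ i = Pf i
  ... | inj₂ j = Pg j

  append : ∀ {n σ d₁ d₂} {N : Matrix n} (F : SignedFamily N σ d₁) (G : SignedFamily N σ d₂) →
           (∀ i j → form N (SignedFamily.vec F i) (SignedFamily.vec G j) ≡ 0ℤ) →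
           (∀ i j → form N (SignedFamily.vec G j) (SignedFamily.vec F i) ≡ 0ℤ) →
           SignedFamily N σ (d₁ ℕ.+ d₂)
  append {n} {σ} {d₁} {d₂} {N} F G F⊥G G⊥F = record
    { vec = F.vec ++ G.vec ; norm = norm ; orth = orth }
    where
    module F = SignedFamily F
    module G = SignedFamily G
    norm : ∀ j → form N ((F.vec ++ G.vec) j) ((F.vec ++ G.vec) j) ≡ σ
    norm j with splitAt d₁ j
    ... | inj₁ i = F.norm i
    ... | inj₂ i = G.norm i
    orth : ∀ {j j′} → j ≢ j′ → form N ((F.vec ++ G.vec) j) ((F.vec ++ G.vec) j′) ≡ 0ℤ
    orth {j} {j′} j≢j′ with splitAt d₁ j in eq | splitAt d₁ j′ in eq′
    ... | inj₁ i | inj₁ i′ = F.orth λ i≡i′ → j≢j′ (trans (sym (splitAt⁻¹-↑ˡ eq))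
                                                     (trans (cong (_↑ˡ d₂) i≡i′) (splitAt⁻¹-↑ˡ eq′)))
    ... | inj₂ i | inj₂ i′ = G.orth λ i≡i′ → j≢j′ (trans (sym (splitAt⁻¹-↑ʳ eq))
                                                     (trans (cong (d₁ ↑ʳ_) i≡i′) (splitAt⁻¹-↑ʳ eq′)))
    ... | inj₁ i | inj₂ i′ = F⊥G i i′
    ... | inj₂ i | inj₁ i′ = G⊥F i′ i

  tensor : ∀ {m n σ τ d} {M : Matrix m} {N : Matrix n} (α : Vector ℤ m) →
           form M α α * σ ≡ τ → SignedFamily N σ d → SignedFamily (M ⊗ N) τ d
  tensor {M = M} {N} α sign F = record
    { vec  = λ j → α ⊗ᵥ vec j
    ; norm = λ j → trans (form-⊗ M N α α (vec j) (vec j)) (trans (cong (form M α α *_) (norm j)) sign)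
    ; orth = λ {i} {j} i≢j → trans (form-⊗ M N α α (vec i) (vec j))
                                    (trans (cong (form M α α *_) (orth i≢j)) (ℤ.*-zeroʳ (form M α α)))
    }
    where open SignedFamily F

  tensor-orth : ∀ {m n} {M : Matrix m} (N : Matrix n) (α β : Vector ℤ m) →
                form M α β ≡ 0ℤ → ∀ φ ψ → form (M ⊗ N) (α ⊗ᵥ φ) (β ⊗ᵥ ψ) ≡ 0ℤ
  tensor-orth {M = M} N α β α⊥β φ ψ =
    trans (form-⊗ M N α β φ ψ) (trans (cong (_* form N φ ψ) α⊥β) (ℤ.*-zeroˡ (form N φ ψ)))

module LinearSystems where

  open BilinearForms
  open import Data.Nat as ℕ using (ℕ; zero; suc; s≤s)
  import Data.Nat.Properties as ℕ
  open import Data.Fin using (Fin; zero; suc; punchIn)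
  open import Data.Fin.Properties using (any?)
  open import Data.Vec.Functional using (Vector; insertAt)
  open import Data.Vec.Functional.Properties using (insertAt-lookup; insertAt-punchIn)
  open import Data.Integer using (ℤ; 0ℤ; 1ℤ; _+_; _*_; -_; _-_)
  import Data.Integer.Properties as ℤ
  open import Data.Integer.Tactic.RingSolver using (solve-∀)
  open import Data.Product using (∃; _×_; _,_)
  open import Data.Sum using (_⊎_; inj₁; inj₂)
  open import Relation.Nullary using (yes; no; ¬?)
  open import Relation.Nullary.Decidable using (decidable-stable)
  open import Relation.Binary.PropositionalEquality
  open import Algebra.Properties.Semiring.Sum ℤ.+-*-semiring using (sum-remove; sum-replicate-zero)

  NonZeroVector : ∀ {n} → Vector ℤ n → Set
  NonZeroVector c = ∃ λ j → c j ≢ 0ℤ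

  nonzero-or-zero : ∀ {n} (f : Vector ℤ n) → NonZeroVector f ⊎ (∀ j → f j ≡ 0ℤ)
  nonzero-or-zero f with any? (λ j → ¬? (f j ℤ.≟ 0ℤ))
  ... | yes f≢0 = inj₁ f≢0
  ... | no ¬f≢0 = inj₂ λ j → decidable-stable (f j ℤ.≟ 0ℤ) (λ fj≢0 → ¬f≢0 (j , fj≢0))

  ·-linear : ∀ {n} (a b : ℤ) (x y c : Vector ℤ n) →
             (λ u → a * x u - b * y u) · c ≡ a * (x · c) - b * (y · c)
  ·-linear {n} a b x y c = begin
    ∑[ u < n ] ((a * x u - b * y u) * c u)
      ≡⟨ sum-cong-≗ (λ u → distribute a b (x u) (y u) (c u)) ⟩
    ∑[ u < n ] (a * (x u * c u) + - b * (y u * c u))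
      ≡⟨ ∑-distrib-+ (λ u → a * (x u * c u)) (λ u → - b * (y u * c u)) ⟩
    ∑[ u < n ] (a * (x u * c u)) + ∑[ u < n ] (- b * (y u * c u))
      ≡⟨ cong₂ _+_ (sym (*-distribˡ-sum a (λ u → x u * c u)))
                   (sym (*-distribˡ-sum (- b) (λ u → y u * c u))) ⟩
    a * (x · c) + - b * (y · c)
      ≡⟨ regroup a b (x · c) (y · c) ⟩
    a * (x · c) - b * (y · c) ∎
    where
    open ≡-Reasoning
    distribute : ∀ a b x y c → (a * x - b * y) * c ≡ a * (x * c) + - b * (y * c)
    distribute = solve-∀
    regroup : ∀ a b s t → a * s + - b * t ≡ a * s - b * t
    regroup = solve-∀

  ·-insertAt : ∀ {p} (r : Vector ℤ (suc p)) (c : Vector ℤ p) j₀ t →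
               r · insertAt c j₀ t ≡ r j₀ * t + (λ l → r (punchIn j₀ l)) · c
  ·-insertAt {p} r c j₀ t = begin
    r · insertAt c j₀ t
      ≡⟨ sum-remove {i = j₀} (λ u → r u * insertAt c j₀ t u) ⟩
    r j₀ * insertAt c j₀ t j₀ + ∑[ l < p ] (r (punchIn j₀ l) * insertAt c j₀ t (punchIn j₀ l))
      ≡⟨ cong₂ (λ x y → r j₀ * x + y) (insertAt-lookup c j₀ t)
               (sum-cong-≗ λ l → cong (r (punchIn j₀ l) *_) (insertAt-punchIn c j₀ t l)) ⟩
    r j₀ * t + (λ l → r (punchIn j₀ l)) · c ∎
    where open ≡-Reasoning

  -- The system in p unknowns obtained by clearing column j₀ from rows 1..k,
  -- using row 0 as pivot row, and dropping that column.
  reduce : ∀ {k p} → (Fin (suc k) → Vector ℤ (suc p)) → Fin (suc p) → Fin k → Vector ℤ p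
  reduce L j₀ i l = L zero j₀ * L (suc i) (punchIn j₀ l) - L (suc i) j₀ * L zero (punchIn j₀ l)

  extend : ∀ {k p} (L : Fin (suc k) → Vector ℤ (suc p)) j₀ → L zero j₀ ≢ 0ℤ →
           (∃ λ c′ → NonZeroVector c′ × ∀ i → reduce L j₀ i · c′ ≡ 0ℤ) →
           ∃ λ c → NonZeroVector c × ∀ i → L i · c ≡ 0ℤ
  extend {k} {p} L j₀ a≢0 (c′ , (l , c′l≢0) , solves) = c , (punchIn j₀ l , c≢0) , c-solves
    where
    a = L zero j₀
    row′ : Fin (suc k) → Vector ℤ p
    row′ i l = L i (punchIn j₀ l)
    S = row′ zero · c′
    c = insertAt (λ l → a * c′ l) j₀ (- S)
    c≢0 : c (punchIn j₀ l) ≢ 0ℤ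
    c≢0 cl≡0 with ℤ.i*j≡0⇒i≡0∨j≡0 a (trans (sym (insertAt-punchIn _ j₀ (- S) l)) cl≡0)
    ... | inj₁ a≡0   = a≢0 a≡0
    ... | inj₂ c′l≡0 = c′l≢0 c′l≡0
    expand : ∀ i → L i · c ≡ L i j₀ * (- S) + a * (row′ i · c′)
    expand i = trans (·-insertAt (L i) (λ l → a * c′ l) j₀ (- S))
                     (cong (L i j₀ * (- S) +_)
                       (trans (sum-cong-≗ λ u → swap (row′ i u) a (c′ u))
                              (sym (*-distribˡ-sum a (λ u → row′ i u * c′ u)))))
      where swap : ∀ r a c → r * (a * c) ≡ a * (r * c)
            swap = solve-∀
    c-solves : ∀ i → L i · c ≡ 0ℤ
    c-solves zero    = trans (expand zero) (cancel a S)
      where cancel : ∀ a S → a * (- S) + a * S ≡ 0ℤ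
            cancel = solve-∀
    c-solves (suc i) = begin
      L (suc i) · c                                          ≡⟨ expand (suc i) ⟩
      L (suc i) j₀ * (- S) + a * (row′ (suc i) · c′)         ≡⟨ reorder (L (suc i) j₀) S a _ ⟩
      a * (row′ (suc i) · c′) - L (suc i) j₀ * S
        ≡⟨ ·-linear a (L (suc i) j₀) (row′ (suc i)) (row′ zero) c′ ⟨
      reduce L j₀ i · c′                                     ≡⟨ solves i ⟩
      0ℤ                                                     ∎
      where open ≡-Reasoning
            reorder : ∀ b S a t → b * (- S) + a * t ≡ a * t - b * S
            reorder = solve-∀

  homogeneous-solution : ∀ {k p} → k ℕ.< p → (L : Fin k → Vector ℤ p) →
                         ∃ λ c → NonZeroVector c × ∀ i → L i · c ≡ 0ℤ
  homogeneous-solution {zero}  {suc p} _ L = (λ _ → 1ℤ) , (zero , λ ()) , λ ()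
  homogeneous-solution {suc k} {suc p} (s≤s k<p) L with nonzero-or-zero (L zero)
  ... | inj₁ (j₀ , pivot≢0) = extend L j₀ pivot≢0 (homogeneous-solution k<p (reduce L j₀))
  ... | inj₂ L₀≡0 with homogeneous-solution (ℕ.m<n⇒m<1+n k<p) (λ i → L (suc i))
  ...   | c , c≢0 , solves = c , c≢0 , λ where
    zero    → trans (sum-cong-≗ λ u → cong (_* c u) (L₀≡0 u))
                    (trans (sum-cong-≗ λ u → ℤ.*-zeroˡ (c u)) (sum-replicate-zero (suc p)))
    (suc i) → solves i

module InertiaBound where

  open import Defs hiding (sym)
  open BilinearForms
  open LinearSystems
  open import Data.Nat as ℕ using (ℕ; zero; suc; _≤_)
  import Data.Nat.Properties as ℕ
  open import Data.Bool using (true; false; if_then_else_)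
  open import Data.Fin using (Fin; zero; suc)
  open import Data.Fin.Subset using (Subset; _∈_)
  open import Data.Vec using (lookup)
  open import Data.Vec.Properties using ([]=⇒lookup; lookup⇒[]=)
  open import Data.Vec.Functional using (Vector; _∷_)
  open import Data.Integer using (ℤ; 0ℤ; 1ℤ; +_; -[1+_]; ∣_∣; _+_; _*_; -_)
  import Data.Integer.Properties as ℤ
  open import Algebra.Properties.Semiring.Sum ℤ.+-*-semiring using (sum-replicate-zero)
  open import Data.Integer.Tactic.RingSolver using (solve-∀)
  open import Data.Product using (∃; _×_; _,_; proj₁; proj₂)
  open import Data.Sum using (inj₁; inj₂; [_,_]′)
  open import Function using (id)
  open import Relation.Nullary using (¬_; yes; no; does; contradiction)
  open import Relation.Binary.PropositionalEquality

  square-nonneg : ∀ x → x * x ≡ + (∣ x ∣ ℕ.* ∣ x ∣)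
  square-nonneg (+ zero)  = refl
  square-nonneg (+ suc n) = refl
  square-nonneg -[1+ n ]  = refl

  sum-squares-nonneg : ∀ {d} (c : Vector ℤ d) → ∃ λ n → ∑[ j < d ] (c j * c j) ≡ + n
  sum-squares-nonneg {zero}  c = 0 , refl
  sum-squares-nonneg {suc d} c with sum-squares-nonneg (λ j → c (suc j))
  ... | n , rest≡n = ∣ c zero ∣ ℕ.* ∣ c zero ∣ ℕ.+ n , cong₂ _+_ (square-nonneg (c zero)) rest≡n

  squares-vanish : ∀ {d} (c : Vector ℤ d) → ∑[ j < d ] (c j * c j) ≡ 0ℤ → ∀ j → c j ≡ 0ℤ
  squares-vanish {suc d} c total≡0 = vanish
    where
    c₀ = c zero
    tail-squares = sum-squares-nonneg (λ j → c (suc j))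
    parts≡0 : ∣ c₀ ∣ ℕ.* ∣ c₀ ∣ ℕ.+ proj₁ tail-squares ≡ 0
    parts≡0 = ℤ.+-injective (trans (sym (cong₂ _+_ (square-nonneg c₀) (proj₂ tail-squares))) total≡0)
    vanish : ∀ j → c j ≡ 0ℤ
    vanish zero    = [ id , id ]′ (ℤ.i*j≡0⇒i≡0∨j≡0 c₀
                       (trans (square-nonneg c₀) (cong +_ (ℕ.m+n≡0⇒m≡0 _ parts≡0))))
    vanish (suc j) = squares-vanish (λ j → c (suc j))
                       (trans (proj₂ tail-squares) (cong +_ (ℕ.m+n≡0⇒n≡0 _ parts≡0))) j

  χ : ∀ {n} → Subset n → Vector ℤ n
  χ S u = if lookup S u then 1ℤ else 0ℤ

  χ-∈ : ∀ {n} {S : Subset n} {u} → u ∈ S → χ S u ≡ 1ℤ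
  χ-∈ u∈S rewrite []=⇒lookup u∈S = refl

  χ-pair : ∀ {n} (S T : Subset n) {u v} → ¬ (u ∈ S × v ∈ T) → χ S u * χ T v ≡ 0ℤ
  χ-pair S T {u} {v} ¬u∈S×v∈T with lookup S u in eqS | lookup T v in eqT
  ... | false | _     = refl
  ... | true  | false = ℤ.*-zeroʳ 1ℤ
  ... | true  | true  = contradiction (lookup⇒[]= u S eqS , lookup⇒[]= v T eqT) ¬u∈S×v∈T

  module _ (G : Graph) where

    -- The 0/1 adjacency matrix A of G and the matrix J - A of non-adjacency
    -- (its diagonal is 1, since G has no loops).
    adjacency coadjacency : Matrix (n G)
    adjacency   u v = if does (adj? G u v) then 1ℤ else 0ℤ
    coadjacency u v = if does (adj? G u v) then 0ℤ else 1ℤ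

    coadjacency+adjacency : ∀ u v → coadjacency u v + adjacency u v ≡ 𝟙 u * 𝟙 v
    coadjacency+adjacency u v with does (adj? G u v)
    ... | true  = refl
    ... | false = refl

    edges : Biclique G → Matrix (n G)
    edges H u v = χ (partA H) u * χ (partB H) v + χ (partB H) u * χ (partA H) v

    edges-∈ : ∀ H {u v} → EdgeIn H u v → edges H u v ≡ 1ℤ
    edges-∈ H (inj₁ (u∈A , v∈B)) =
      cong₂ _+_ (cong₂ _*_ (χ-∈ u∈A) (χ-∈ v∈B))
                (χ-pair (partB H) (partA H) λ (u∈B , _) → disjoint H _ u∈A u∈B)
    edges-∈ H (inj₂ (v∈A , u∈B)) =
      cong₂ _+_ (χ-pair (partA H) (partB H) λ (u∈A , _) → disjoint H _ u∈A u∈B)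
                (cong₂ _*_ (χ-∈ u∈B) (χ-∈ v∈A))

    edges-∉ : ∀ H {u v} → ¬ EdgeIn H u v → edges H u v ≡ 0ℤ
    edges-∉ H ¬uv = cong₂ _+_ (χ-pair (partA H) (partB H) λ u∈A×v∈B → ¬uv (inj₁ u∈A×v∈B))
                              (χ-pair (partB H) (partA H) λ (u∈B , v∈A) → ¬uv (inj₂ (v∈A , u∈B)))

    EdgeIn⇒Adj : ∀ (H : Biclique G) {u v} → EdgeIn H u v → Adj G u v
    EdgeIn⇒Adj H (inj₁ (u∈A , v∈B)) = complete H _ _ u∈A v∈B
    EdgeIn⇒Adj H (inj₂ (v∈A , u∈B)) = Graph.sym G (complete H _ _ v∈A u∈B)

    adjacency-partition : ∀ {k} (Hs : Fin k → Biclique G) → IsBicliquePartition G k Hs →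
                          ∀ u v → adjacency u v ≡ ∑[ i < k ] edges (Hs i) u v
    adjacency-partition {k} Hs (covers , unique) u v with adj? G u v
    ... | yes uv with covers u v uv
    ...   | i , uv∈Hsi =
      sym (trans (∑-single (λ j → edges (Hs j) u v) i
                   λ j j≢i → edges-∉ (Hs j) λ uv∈Hsj → j≢i (unique u v uv j i uv∈Hsj uv∈Hsi))
                 (edges-∈ (Hs i) uv∈Hsi))
    adjacency-partition {k} Hs _ u v | no ¬uv =
      sym (trans (sum-cong-≗ λ i → edges-∉ (Hs i) λ uv∈Hsi → ¬uv (EdgeIn⇒Adj (Hs i) uv∈Hsi))
                 (sum-replicate-zero k))

    adjacency-form : ∀ {k} (Hs : Fin k → Biclique G) → IsBicliquePartition G k Hs →
                     ∀ z → (∀ i → χ (partA (Hs i)) · z ≡ 0ℤ) → form adjacency z z ≡ 0ℤ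
    adjacency-form {k} Hs P z A⊥z = begin
      form adjacency z z
        ≡⟨ form-cong (adjacency-partition Hs P) z z ⟩
      form (λ u v → ∑[ i < k ] edges (Hs i) u v) z z
        ≡⟨ form-∑ (λ i → edges (Hs i)) z z ⟩
      ∑[ i < k ] form (edges (Hs i)) z z
        ≡⟨ sum-cong-≗ part-form ⟩
      ∑[ i < k ] 0ℤ
        ≡⟨ sum-replicate-zero k ⟩
      0ℤ ∎
      where
      open ≡-Reasoning
      part-form : ∀ i → form (edges (Hs i)) z z ≡ 0ℤ
      part-form i = begin
        form (edges (Hs i)) z z
          ≡⟨ form-+ (λ u v → a u * b v) (λ u v → b u * a v) z z ⟩
        form (λ u v → a u * b v) z z + form (λ u v → b u * a v) z z
          ≡⟨ cong₂ _+_ (form-outer a b z z) (form-outer b a z z) ⟩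
        (a · z) * (b · z) + (b · z) * (a · z)
          ≡⟨ cong (λ t → t * (b · z) + (b · z) * t) (A⊥z i) ⟩
        0ℤ * (b · z) + (b · z) * 0ℤ
          ≡⟨ cong (λ t → 0ℤ + t) (ℤ.*-zeroʳ (b · z)) ⟩
        0ℤ ∎
        where a = χ (partA (Hs i))
              b = χ (partB (Hs i))

    coadjacency-form : ∀ {k} (Hs : Fin k → Biclique G) → IsBicliquePartition G k Hs →
                       ∀ z → (∀ i → χ (partA (Hs i)) · z ≡ 0ℤ) →
                       form coadjacency z z ≡ (𝟙 · z) * (𝟙 · z)
    coadjacency-form Hs P z A⊥z = begin
      form coadjacency z z
        ≡⟨ ℤ.+-identityʳ _ ⟨
      form coadjacency z z + 0ℤ
        ≡⟨ cong (λ t → form coadjacency z z + t) (adjacency-form Hs P z A⊥z) ⟨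
      form coadjacency z z + form adjacency z z
        ≡⟨ form-+ coadjacency adjacency z z ⟨
      form (λ u v → coadjacency u v + adjacency u v) z z
        ≡⟨ form-cong coadjacency+adjacency z z ⟩
      form (λ u v → 𝟙 u * 𝟙 v) z z
        ≡⟨ form-outer 𝟙 𝟙 z z ⟩
      (𝟙 · z) * (𝟙 · z) ∎
      where open ≡-Reasoning

    -- A partition into k parts admits no (-1)-signed family of d > k vectors:
    -- some nonzero combination z of the family is orthogonal to side A of every
    -- part (k equations in d unknowns), and then (∑ z)² = zᵀ(J - A)z = -∑ cⱼ²
    -- forces every cⱼ to vanish.
    no-small-partition : ∀ {d k} (Hs : Fin k → Biclique G) → IsBicliquePartition G k Hs →
                         SignedFamily coadjacency (- 1ℤ) d → ¬ (k ℕ.< d)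
    no-small-partition {d} Hs P F k<d
      with homogeneous-solution k<d (λ i j → χ (partA (Hs i)) · SignedFamily.vec F j)
    ... | c , (j₀ , cj₀≢0) , solves = cj₀≢0 (squares-vanish (𝟙 · z ∷ c) squares≡0 (suc j₀))
      where
      open ≡-Reasoning
      open SignedFamily F
      z = combination c vec
      A⊥z : ∀ i → χ (partA (Hs i)) · z ≡ 0ℤ
      A⊥z i = trans (·-combination (χ (partA (Hs i))) c vec) (solves i)
      cancel : ∀ s → - 1ℤ * s + s ≡ 0ℤ
      cancel = solve-∀
      squares≡0 : (𝟙 · z) * (𝟙 · z) + ∑[ j < d ] (c j * c j) ≡ 0ℤ
      squares≡0 = begin
        (𝟙 · z) * (𝟙 · z) + ∑[ j < d ] (c j * c j)
          ≡⟨ cong (_+ ∑[ j < d ] (c j * c j)) (coadjacency-form Hs P z A⊥z) ⟨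
        form coadjacency z z + ∑[ j < d ] (c j * c j)
          ≡⟨ cong (_+ ∑[ j < d ] (c j * c j)) (form-span F c) ⟩
        - 1ℤ * ∑[ j < d ] (c j * c j) + ∑[ j < d ] (c j * c j)
          ≡⟨ cancel (∑[ j < d ] (c j * c j)) ⟩
        0ℤ ∎

    partition-bound : ∀ {d} → SignedFamily coadjacency (- 1ℤ) d →
                      ∀ k (Hs : Fin k → Biclique G) → IsBicliquePartition G k Hs → d ≤ k
    partition-bound F k Hs P = ℕ.≮⇒≥ (no-small-partition Hs P F)

module Bicliques where

  open import Defs hiding (sym)
  open import Level using (0ℓ)
  open import Data.Nat using (_≤_)
  open import Data.Fin using (Fin)
  open import Data.Fin.Properties using (injective⇒≤; _≟_)
  open import Data.Fin.Subset using (Subset; _∈_)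
  open import Data.Vec using (tabulate)
  open import Data.Vec.Properties using ([]=⇒lookup; lookup⇒[]=; lookup∘tabulate)
  open import Data.Product using (∃; _×_; _,_; proj₁; proj₂)
  open import Data.Sum using (_⊎_; inj₁; inj₂)
  open import Data.Empty using (⊥)
  open import Relation.Unary using (Pred; Decidable)
  open import Relation.Nullary using (¬_; yes; no; does; contradiction)
  open import Relation.Nullary.Decidable using (dec-true)
  open import Relation.Binary.PropositionalEquality

  subset : ∀ {n} {P : Pred (Fin n) 0ℓ} → Decidable P → Subset n
  subset P? = tabulate λ u → does (P? u)

  ∈-subset⁺ : ∀ {n} {P : Pred (Fin n) 0ℓ} (P? : Decidable P) {u} → P u → u ∈ subset P?
  ∈-subset⁺ P? {u} Pu = lookup⇒[]= u _ (trans (lookup∘tabulate _ u) (dec-true (P? u) Pu))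

  ∈-subset⁻ : ∀ {n} {P : Pred (Fin n) 0ℓ} (P? : Decidable P) {u} → u ∈ subset P? → P u
  ∈-subset⁻ P? {u} u∈S with P? u | trans (sym (lookup∘tabulate (λ v → does (P? v)) u)) ([]=⇒lookup u∈S)
  ... | yes Pu | _  = Pu
  ... | no _   | ()

  record BicliqueSpec (G : Graph) : Set₁ where
    field
      SideA SideB : Pred (Fin (n G)) 0ℓ
      sideA? : Decidable SideA
      sideB? : Decidable SideB
      inhabitedA : ∃ SideA
      inhabitedB : ∃ SideB
      separated : ∀ v → SideA v → SideB v → ⊥
      joined : ∀ a b → SideA a → SideB b → Adj G a b

    Joins : Fin (n G) → Fin (n G) → Set
    Joins u v = (SideA u × SideB v) ⊎ (SideA v × SideB u)

    biclique : Biclique G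
    biclique = record
      { partA = subset sideA?
      ; partB = subset sideB?
      ; nonemptyA = proj₁ inhabitedA , ∈-subset⁺ sideA? (proj₂ inhabitedA)
      ; nonemptyB = proj₁ inhabitedB , ∈-subset⁺ sideB? (proj₂ inhabitedB)
      ; disjoint = λ v v∈A v∈B → separated v (∈-subset⁻ sideA? v∈A) (∈-subset⁻ sideB? v∈B)
      ; complete = λ a b a∈A b∈B → joined a b (∈-subset⁻ sideA? a∈A) (∈-subset⁻ sideB? b∈B)
      }

    edgeIn⁺ : ∀ {u v} → Joins u v → EdgeIn biclique u v
    edgeIn⁺ (inj₁ (Au , Bv)) = inj₁ (∈-subset⁺ sideA? Au , ∈-subset⁺ sideB? Bv)
    edgeIn⁺ (inj₂ (Av , Bu)) = inj₂ (∈-subset⁺ sideA? Av , ∈-subset⁺ sideB? Bu)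

    edgeIn⁻ : ∀ {u v} → EdgeIn biclique u v → Joins u v
    edgeIn⁻ (inj₁ (u∈A , v∈B)) = inj₁ (∈-subset⁻ sideA? u∈A , ∈-subset⁻ sideB? v∈B)
    edgeIn⁻ (inj₂ (v∈A , u∈B)) = inj₂ (∈-subset⁻ sideA? v∈A , ∈-subset⁻ sideB? u∈B)

  -- Fooling-set bound: if the edges xᵢyᵢ (i < m) satisfy, for i ≢ j, that xᵢ is
  -- adjacent neither to yⱼ nor to xⱼ, then no biclique contains two of them,
  -- so every biclique cover has at least m members.
  fooling-set-bound : ∀ {m} (G : Graph) (x y : Fin m → Fin (n G)) →
                      (∀ i → Adj G (x i) (y i)) →
                      (∀ {i j} → i ≢ j → ¬ Adj G (x i) (y j)) →
                      (∀ {i j} → i ≢ j → ¬ Adj G (x i) (x j)) →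
                      ∀ k (Hs : Fin k → Biclique G) → IsBicliqueCover G k Hs → m ≤ k
  fooling-set-bound G x y xy-edge xy-apart xx-apart k Hs cover = injective⇒≤ {f = part} injective
    where
    part : Fin _ → Fin k
    part i = proj₁ (cover (x i) (y i) (xy-edge i))
    inPart : ∀ i → EdgeIn (Hs (part i)) (x i) (y i)
    inPart i = proj₂ (cover (x i) (y i) (xy-edge i))
    clash : ∀ {i j} (H : Biclique G) → i ≢ j → EdgeIn H (x i) (y i) → EdgeIn H (x j) (y j) → ⊥
    clash H i≢j (inj₁ (xi∈A , _)) (inj₁ (_ , yj∈B)) = xy-apart i≢j (complete H _ _ xi∈A yj∈B)
    clash H i≢j (inj₁ (xi∈A , _)) (inj₂ (_ , xj∈B)) = xx-apart i≢j (complete H _ _ xi∈A xj∈B)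
    clash H i≢j (inj₂ (_ , xi∈B)) (inj₁ (xj∈A , _)) =
      xx-apart (λ j≡i → i≢j (sym j≡i)) (complete H _ _ xj∈A xi∈B)
    clash H i≢j (inj₂ (_ , xi∈B)) (inj₂ (yj∈A , _)) =
      xy-apart i≢j (Graph.sym G (complete H _ _ yj∈A xi∈B))
    injective : ∀ {i j} → part i ≡ part j → i ≡ j
    injective {i} {j} same with i ≟ j
    ... | yes i≡j = i≡j
    ... | no i≢j  = contradiction (subst (λ p → EdgeIn (Hs p) (x j) (y j)) (sym same) (inPart j))
                                  (clash (Hs (part i)) i≢j (inPart i))

module Words where

  open import Defs hiding (sym)
  open import Data.Nat using (ℕ; suc; _*_; _^_)
  open import Data.Fin using (Fin; suc; combine; quotient; remainder; finToFun; funToFin)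
  open import Data.Fin.Properties using (any?; _≟_; remQuot-combine; combine-remQuot; finToFun-funToFin)
  open import Data.Fin.Patterns using (0F; 1F; 2F)
  open import Data.Product using (∃; _×_; _,_; proj₁; proj₂)
  open import Data.Sum using (_⊎_; inj₁; inj₂)
  open import Relation.Nullary using (¬_; Dec; yes; no; does)
  open import Relation.Nullary.Decidable using (dec-true)
  open import Data.Bool using (if_then_else_)
  open import Relation.Binary.PropositionalEquality

  -- A word of length m over {0, 1, 2}, encoded as an element of Fin (3 ^ m).
  Word : ℕ → Set
  Word m = Fin (3 ^ m)

  letter : ∀ {m} → Word m → Fin m → Fin 3
  letter = finToFun

  -- Elements of Fin (3 * k) split into a head in Fin 3 and a tail in Fin k; for
  -- a word of length m + 1 these are its first letter and the remaining word.
  head : ∀ k → Fin (3 * k) → Fin 3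
  head k = quotient k

  tail : ∀ k → Fin (3 * k) → Fin k
  tail k = remainder {3} k

  head-combine : ∀ {k} (a : Fin 3) (x : Fin k) → head k (combine a x) ≡ a
  head-combine a x = cong proj₁ (remQuot-combine a x)

  tail-combine : ∀ {k} (a : Fin 3) (x : Fin k) → tail k (combine a x) ≡ x
  tail-combine a x = cong proj₂ (remQuot-combine a x)

  head-tail-injective : ∀ k {r r′ : Fin (3 * k)} →
                        head k r ≡ head k r′ → tail k r ≡ tail k r′ → r ≡ r′
  head-tail-injective k {r} {r′} h≡ t≡ =
    trans (sym (combine-remQuot {3} k r)) (trans (cong₂ (combine {3} {k}) h≡ t≡) (combine-remQuot {3} k r′))

  data Opposite : Fin 3 → Fin 3 → Set where
    0-1 : Opposite 0F 1F
    1-0 : Opposite 1F 0F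

  opposite? : ∀ a b → Dec (Opposite a b)
  opposite? 0F 1F = yes 0-1
  opposite? 1F 0F = yes 1-0
  opposite? 0F 0F = no λ ()
  opposite? 0F 2F = no λ ()
  opposite? 1F 1F = no λ ()
  opposite? 1F 2F = no λ ()
  opposite? 2F _  = no λ ()

  opposite-sym : ∀ {a b} → Opposite a b → Opposite b a
  opposite-sym 0-1 = 1-0
  opposite-sym 1-0 = 0-1

  opposite-irrefl : ∀ {a} → ¬ Opposite a a
  opposite-irrefl ()

  opposite-letters : ∀ {a b} → Opposite a b → (a ≡ 0F × b ≡ 1F) ⊎ (b ≡ 0F × a ≡ 1F)
  opposite-letters 0-1 = inj₁ (refl , refl)
  opposite-letters 1-0 = inj₂ (refl , refl)

  Adjacent : ∀ {m} → Word m → Word m → Set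
  Adjacent {m} u v = ∃ λ (i : Fin m) → Opposite (letter u i) (letter v i)

  G : ℕ → Graph
  G m = record
    { n      = 3 ^ m
    ; Adj    = Adjacent {m}
    ; adj?   = λ u v → any? λ (i : Fin m) → opposite? (letter u i) (letter v i)
    ; sym    = λ (i , opp) → i , opposite-sym opp
    ; irrefl = λ (i , opp) → opposite-irrefl opp
    }

  first : ∀ m → Word (suc m) → Fin 3
  first m = head (3 ^ m)

  rest : ∀ m → Word (suc m) → Word m
  rest m = tail (3 ^ m)

  cons : ∀ m → Fin 3 → Word m → Word (suc m)
  cons m = combine {3} {3 ^ m}

  first-cons : ∀ m s x → first m (cons m s x) ≡ s
  first-cons m = head-combine

  rest-cons : ∀ m s x → rest m (cons m s x) ≡ x
  rest-cons m = tail-combine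

  twos : ∀ m → Word m
  twos m = funToFin {m} λ _ → 2F

  adjacent-rest : ∀ {m} {u v : Word (suc m)} → Adjacent {m} (rest m u) (rest m v) → Adjacent u v
  adjacent-rest (i , opp) = suc i , opp

  spike : ∀ {m} → Fin 3 → Fin m → Word m
  spike s i = funToFin λ l → if does (l ≟ i) then s else 2F

  letter-spike : ∀ {m} s (i : Fin m) → letter (spike s i) i ≡ s
  letter-spike s i = trans (finToFun-funToFin _ i) (cong (λ b → if b then s else 2F) (dec-true (i ≟ i) refl))

  -- Away from its position a spike carries the letter 2, opposite to nothing.
  spike-support : ∀ {m s t} {i l : Fin m} → Opposite (letter (spike s i) l) t → l ≡ i
  spike-support {s = s} {t} {i} {l} opp
    with l ≟ i | subst (λ a → Opposite a t) (finToFun-funToFin _ l) opp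
  ... | yes l≡i | _ = l≡i
  ... | no _    | ()

  spikes-apart : ∀ {m s t} {i j : Fin m} → i ≢ j → ¬ Adjacent {m} (spike s i) (spike t j)
  spikes-apart {s = s} {t} {i} {j} i≢j (l , opp) =
    i≢j (trans (sym (spike-support {s = s} {i = i} {l} opp))
               (spike-support {s = t} {i = j} {l} (opposite-sym opp)))

  spike-edge : ∀ {m} (i : Fin m) → Adjacent {m} (spike 0F i) (spike 1F i)
  spike-edge i = i , subst₂ Opposite (sym (letter-spike 0F i)) (sym (letter-spike 1F i)) 0-1

module CoverNumber where

  open import Defs hiding (sym)
  open Bicliques
  open Words
  open import Data.Fin using (Fin)
  open import Data.Fin.Properties using (_≟_)
  open import Data.Fin.Patterns using (0F; 1F)
  open import Data.Product using (_,_)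
  open import Relation.Binary.PropositionalEquality

  position : ∀ m → Fin m → BicliqueSpec (G m)
  position m i = record
    { SideA      = λ u → letter u i ≡ 0F
    ; SideB      = λ u → letter u i ≡ 1F
    ; sideA?     = λ u → letter u i ≟ 0F
    ; sideB?     = λ u → letter u i ≟ 1F
    ; inhabitedA = spike 0F i , letter-spike 0F i
    ; inhabitedB = spike 1F i , letter-spike 1F i
    ; separated  = λ v v₀ v₁ → 0≢1 (trans (sym v₀) v₁)
    ; joined     = λ a b a₀ b₁ → i , subst₂ Opposite (sym a₀) (sym b₁) 0-1
    }
    where 0≢1 : 0F ≢ 1F
          0≢1 ()

  position-cover : ∀ m → IsBicliqueCover (G m) m (λ i → BicliqueSpec.biclique (position m i))
  position-cover m u v (i , opp) = i , BicliqueSpec.edgeIn⁺ (position m i) (opposite-letters opp)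

  bc-value : ∀ m → bcIs (G m) m
  bc-value m = ((λ i → BicliqueSpec.biclique (position m i)) , position-cover m) ,
               fooling-set-bound (G m) (spike 0F) (spike 1F) spike-edge spikes-apart spikes-apart

module Partition where

  open import Defs hiding (sym)
  open Bicliques
  open Words
  open import Data.Nat using (ℕ; zero; suc; _*_; _^_; _∸_)
  open import Data.Fin using (Fin; zero; suc; combine)
  open import Data.Fin.Properties using (_≟_)
  open import Data.Fin.Patterns using (0F; 1F)
  open import Data.Product using (∃; _×_; _,_)
  open import Data.Sum using (inj₁; inj₂)
  open import Data.Empty using (⊥; ⊥-elim)
  open import Relation.Unary using (Decidable)
  open import Relation.Nullary using (¬_; yes; no; ¬?; contradiction)
  open import Relation.Nullary.Decidable using (_×-dec_)
  open import Relation.Binary.PropositionalEquality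
  open import Function using (_∘_)
  open import Data.Nat.Tactic.RingSolver using (solve-∀)

  -- The number of parts, (3 ^ m - 1) / 2.
  pieces : ℕ → ℕ
  pieces zero    = 0
  pieces (suc m) = suc (3 * pieces m)

  three-power : ∀ m → 3 ^ m ≡ suc (2 * pieces m)
  three-power zero    = refl
  three-power (suc m) = trans (cong (3 *_) (three-power m)) (triple (pieces m))
    where triple : ∀ p → 3 * suc (2 * p) ≡ suc (2 * suc (3 * p))
          triple = solve-∀

  pieces-formula : ∀ m → 2 * pieces m ≡ 3 ^ m ∸ 1
  pieces-formula m = cong (_∸ 1) (sym (three-power m))

  -- A part 1 + r of G (m + 1) other than part 0 is labelled by a letter and a part of G m.
  label : ∀ m → Fin (3 * pieces m) → Fin 3
  label m = head (pieces m)

  subpart : ∀ m → Fin (3 * pieces m) → Fin (pieces m)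
  subpart m = tail (pieces m)

  lift : ∀ m → Fin 3 → Fin (pieces m) → Fin (3 * pieces m)
  lift m = combine {3} {pieces m}

  -- Part 0 of G (m + 1) joins the words
  -- beginning with 0 to those beginning with 1. The part labelled by the letter s
  -- and the part r of G m joins the words s x, with x on side A of r, to the words
  -- b y with b not opposite to s and y on side B of r.
  SideA SideB : ∀ m → Fin (pieces m) → Word m → Set
  SideA (suc m) zero    u = first m u ≡ 0F
  SideA (suc m) (suc r) u = first m u ≡ label m r × SideA m (subpart m r) (rest m u)
  SideB (suc m) zero    u = first m u ≡ 1F
  SideB (suc m) (suc r) u = ¬ Opposite (label m r) (first m u) × SideB m (subpart m r) (rest m u)

  sideA? : ∀ m r → Decidable (SideA m r)
  sideA? (suc m) zero    u = first m u ≟ 0F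
  sideA? (suc m) (suc r) u = (first m u ≟ label m r) ×-dec sideA? m (subpart m r) (rest m u)
  sideB? : ∀ m r → Decidable (SideB m r)
  sideB? (suc m) zero    u = first m u ≟ 1F
  sideB? (suc m) (suc r) u = ¬? (opposite? (label m r) (first m u)) ×-dec sideB? m (subpart m r) (rest m u)

  inhabitedA : ∀ m r → ∃ (SideA m r)
  inhabitedA (suc m) zero    = cons m 0F (twos m) , first-cons m 0F (twos m)
  inhabitedA (suc m) (suc r) with inhabitedA m (subpart m r)
  ... | x , Ax = cons m (label m r) x ,
                 first-cons m (label m r) x , subst (SideA m (subpart m r)) (sym (rest-cons m (label m r) x)) Ax

  inhabitedB : ∀ m r → ∃ (SideB m r)
  inhabitedB (suc m) zero    = cons m 1F (twos m) , first-cons m 1F (twos m)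
  inhabitedB (suc m) (suc r) with inhabitedB m (subpart m r)
  ... | y , By = cons m (label m r) y ,
                 subst (λ b → ¬ Opposite (label m r) b) (sym (first-cons m (label m r) y)) opposite-irrefl ,
                 subst (SideB m (subpart m r)) (sym (rest-cons m (label m r) y)) By

  separated : ∀ m r v → SideA m r v → SideB m r v → ⊥
  separated (suc m) zero    v v₀ v₁ with trans (sym v₀) v₁
  ... | ()
  separated (suc m) (suc r) v (_ , Av) (_ , Bv) = separated m (subpart m r) (rest m v) Av Bv

  joined : ∀ m r a b → SideA m r a → SideB m r b → Adjacent {m} a b
  joined (suc m) zero    a b a₀ b₁ = zero , subst₂ Opposite (sym a₀) (sym b₁) 0-1
  joined (suc m) (suc r) a b (_ , Aa) (_ , Bb) = adjacent-rest (joined m (subpart m r) _ _ Aa Bb)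

  part : ∀ m → Fin (pieces m) → BicliqueSpec (G m)
  part m r = record
    { SideA = SideA m r ; SideB = SideB m r ; sideA? = sideA? m r ; sideB? = sideB? m r
    ; inhabitedA = inhabitedA m r ; inhabitedB = inhabitedB m r
    ; separated = separated m r ; joined = joined m r }

  Joins : ∀ m → Fin (pieces m) → Word m → Word m → Set
  Joins m r = BicliqueSpec.Joins (part m r)

  lift-A : ∀ m s r u → first m u ≡ s → SideA m r (rest m u) → SideA (suc m) (suc (lift m s r)) u
  lift-A m s r u u≡s Au =
    trans u≡s (sym (head-combine s r)) , subst (λ t → SideA m t (rest m u)) (sym (tail-combine s r)) Au

  lift-B : ∀ m s r v → ¬ Opposite s (first m v) → SideB m r (rest m v) → SideB (suc m) (suc (lift m s r)) v
  lift-B m s r v ¬opp Bv =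
    subst (λ a → ¬ Opposite a (first m v)) (sym (head-combine s r)) ¬opp ,
    subst (λ t → SideB m t (rest m v)) (sym (tail-combine s r)) Bv

  lift-joins : ∀ m r u v → ¬ Opposite (first m u) (first m v) →
               Joins m r (rest m u) (rest m v) → ∃ λ r′ → Joins (suc m) r′ u v
  lift-joins m r u v ¬opp (inj₁ (Au , Bv)) =
    suc (lift m (first m u) r) , inj₁ (lift-A m _ r u refl Au , lift-B m _ r v ¬opp Bv)
  lift-joins m r u v ¬opp (inj₂ (Av , Bu)) =
    suc (lift m (first m v) r) , inj₂ (lift-A m _ r v refl Av , lift-B m _ r u (¬opp ∘ opposite-sym) Bu)

  -- Every edge lies in some part: in part 0 if the first letters are opposite,
  -- otherwise in the lift of a part of G m containing the edge between the tails.
  part-cover : ∀ m u v → Adjacent {m} u v → ∃ λ r → Joins m r u v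
  part-cover (suc m) u v uv with opposite? (first m u) (first m v) | uv
  ... | yes opp | _ with opposite-letters opp
  ...   | inj₁ (u₀ , v₁) = zero , inj₁ (u₀ , v₁)
  ...   | inj₂ (v₀ , u₁) = zero , inj₂ (v₀ , u₁)
  part-cover (suc m) u v uv | no ¬opp | zero , opp = contradiction opp ¬opp
  part-cover (suc m) u v uv | no ¬opp | suc i , opp with part-cover m (rest m u) (rest m v) (i , opp)
  ... | r , joins = lift-joins m r u v ¬opp joins

  part₀-opposite : ∀ m {u v} → Joins (suc m) zero u v → Opposite (first m u) (first m v)
  part₀-opposite m (inj₁ (u₀ , v₁)) = subst₂ Opposite (sym u₀) (sym v₁) 0-1
  part₀-opposite m (inj₂ (v₀ , u₁)) = subst₂ Opposite (sym u₁) (sym v₀) 1-0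

  lifted-not-opposite : ∀ m r {u v} → Joins (suc m) (suc r) u v → ¬ Opposite (first m u) (first m v)
  lifted-not-opposite m r {v = v} (inj₁ ((u≡ , _) , (¬opp , _))) =
    subst (λ a → ¬ Opposite a (first m v)) (sym u≡) ¬opp
  lifted-not-opposite m r {u = u} (inj₂ ((v≡ , _) , (¬opp , _))) =
    subst (λ a → ¬ Opposite a (first m u)) (sym v≡) ¬opp ∘ opposite-sym

  lower : ∀ m r {u v} → Joins (suc m) (suc r) u v → Joins m (subpart m r) (rest m u) (rest m v)
  lower m r (inj₁ ((_ , Au) , (_ , Bv))) = inj₁ (Au , Bv)
  lower m r (inj₂ ((_ , Av) , (_ , Bu))) = inj₂ (Av , Bu)

  part-unique : ∀ m r r′ u v → Joins m r u v → Joins m r′ u v → r ≡ r′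
  part-unique (suc m) zero    zero     u v e e′ = refl
  part-unique (suc m) zero    (suc r′) u v e e′ =
    contradiction (part₀-opposite m e) (lifted-not-opposite m r′ e′)
  part-unique (suc m) (suc r) zero     u v e e′ =
    contradiction (part₀-opposite m e′) (lifted-not-opposite m r e)
  part-unique (suc m) (suc r) (suc r′) u v e e′ =
    cong suc (head-tail-injective (pieces m) (same-label e e′) same-subpart)
    where
    same-subpart : subpart m r ≡ subpart m r′
    same-subpart = part-unique m _ _ (rest m u) (rest m v) (lower m r e) (lower m r′ e′)
    -- the label is the first letter of the A-end, and both parts orient the edge alike
    on-B : ∀ w → SideB m (subpart m r′) (rest m w) → SideB m (subpart m r) (rest m w)
    on-B w = subst (λ t → SideB m t (rest m w)) (sym same-subpart)
    same-label : Joins (suc m) (suc r) u v → Joins (suc m) (suc r′) u v → label m r ≡ label m r′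
    same-label (inj₁ ((u≡ , _) , _)) (inj₁ ((u≡′ , _) , _)) = trans (sym u≡) u≡′
    same-label (inj₂ ((v≡ , _) , _)) (inj₂ ((v≡′ , _) , _)) = trans (sym v≡) v≡′
    same-label (inj₁ ((_ , Au) , _)) (inj₂ (_ , (_ , Bu))) = ⊥-elim (separated m _ (rest m u) Au (on-B u Bu))
    same-label (inj₂ ((_ , Av) , _)) (inj₁ (_ , (_ , Bv))) = ⊥-elim (separated m _ (rest m v) Av (on-B v Bv))

  partition : ∀ m → IsBicliquePartition (G m) (pieces m) (λ r → BicliqueSpec.biclique (part m r))
  partition m =
    (λ u v uv → let r , joins = part-cover m u v uv in r , BicliqueSpec.edgeIn⁺ (part m r) joins) ,
    λ u v _ r r′ e e′ → part-unique m r r′ u v (BicliqueSpec.edgeIn⁻ (part m r) e)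
                                               (BicliqueSpec.edgeIn⁻ (part m r′) e′)

module Signature where

  open import Defs hiding (sym)
  open BilinearForms
  open InertiaBound using (coadjacency)
  open Words using (G; opposite?; first; rest)
  open Partition using (pieces)
  open import Data.Nat as ℕ using (ℕ; zero; suc)
  open import Data.Bool using (true; false; _∨_; if_then_else_)
  open import Data.Fin using (zero; suc)
  open import Data.Fin.Patterns using (0F; 1F; 2F)
  open import Data.Integer using (ℤ; 0ℤ; 1ℤ; _*_; -_)
  import Data.Integer.Properties as ℤ
  open import Data.Vec.Functional using (Vector)
  open import Relation.Nullary using (does; contradiction)
  open import Data.Nat.Tactic.RingSolver using (solve-∀)
  open import Relation.Binary.PropositionalEquality

  -- The non-opposition matrix of the three letters (J - A for G 1).
  M : Matrix 3
  M a b = if does (opposite? a b) then 0ℤ else 1ℤ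

  -- Two words of length m + 1 are non-adjacent iff their first letters are
  -- non-opposite and their tails are non-adjacent: J - A of G (m + 1) is M ⊗ (J - A of G m).
  coadjacency-step : ∀ m u v → (M ⊗ coadjacency (G m)) u v ≡ coadjacency (G (suc m)) u v
  coadjacency-step m u v =
    indicator-∨ (does (opposite? (first m u) (first m v))) (does (adj? (G m) (rest m u) (rest m v)))
    where
    indicator-∨ : ∀ b c → (if b then 0ℤ else 1ℤ) * (if c then 0ℤ else 1ℤ) ≡
                          (if b ∨ c then 0ℤ else 1ℤ)
    indicator-∨ true  c     = refl
    indicator-∨ false true  = refl
    indicator-∨ false false = refl

  -- M has signature (2, 1): e₀ and e₁ have squared length 1, w = (1, 1, -1) has
  -- squared length -1, and the three are pairwise orthogonal.
  e₀ e₁ w : Vector ℤ 3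
  e₀ 0F = 1ℤ
  e₀ _  = 0ℤ
  e₁ 1F = 1ℤ
  e₁ _  = 0ℤ
  w 2F = - 1ℤ
  w _  = 1ℤ

  step : ∀ {m σ d d′} → SignedFamily (coadjacency (G m)) σ d →
         SignedFamily (coadjacency (G m)) (- σ) d′ →
         SignedFamily (coadjacency (G (suc m))) σ (d ℕ.+ (d ℕ.+ d′))
  step {m} {σ} {d} {d′} F F′ =
    reindex (coadjacency-step m)
      (append E₀ (append E₁ W (λ i j → orthogonal e₁ w refl (vec F i) (vec F′ j))
                              (λ i j → orthogonal w e₁ refl (vec F′ j) (vec F i)))
         (λ i → ++-all {P = vec E₀ i ⊥_} (λ j → orthogonal e₀ e₁ refl (vec F i) (vec F j))
                                         (λ j → orthogonal e₀ w refl (vec F i) (vec F′ j)))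
         (λ i → ++-all {P = _⊥ vec E₀ i} (λ j → orthogonal e₁ e₀ refl (vec F j) (vec F i))
                                         (λ j → orthogonal w e₀ refl (vec F′ j) (vec F i))))
    where
    open SignedFamily using (vec)
    N = coadjacency (G m)
    _⊥_ : Vector ℤ (3 ℕ.* 3 ℕ.^ m) → Vector ℤ (3 ℕ.* 3 ℕ.^ m) → Set
    x ⊥ y = form (M ⊗ N) x y ≡ 0ℤ
    orthogonal : ∀ α β → form M α β ≡ 0ℤ → ∀ φ ψ → (α ⊗ᵥ φ) ⊥ (β ⊗ᵥ ψ)
    orthogonal = tensor-orth {M = M} N
    E₀ E₁ : SignedFamily (M ⊗ N) σ d
    E₀ = tensor {M = M} e₀ (ℤ.*-identityˡ σ) F
    E₁ = tensor {M = M} e₁ (ℤ.*-identityˡ σ) F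
    W : SignedFamily (M ⊗ N) σ d′
    W  = tensor {M = M} w (trans (ℤ.-1*i≡-i (- σ)) (ℤ.neg-involutive σ)) F′

  -- J - A of G m has a (-1)-signed family of pieces m vectors and a (+1)-signed
  -- family of pieces m + 1 vectors: G 0 is a single vertex, and each step
  -- replaces (n₋, n₊) by (2 n₋ + n₊, 2 n₊ + n₋).
  negative : ∀ m → SignedFamily (coadjacency (G m)) (- 1ℤ) (pieces m)
  positive : ∀ m → SignedFamily (coadjacency (G m)) 1ℤ (suc (pieces m))

  negative zero    = record { vec = λ () ; norm = λ () ; orth = λ { {()} } }
  negative (suc m) = subst (SignedFamily _ (- 1ℤ)) (count (pieces m)) (step {m} (negative m) (positive m))
    where count : ∀ p → p ℕ.+ (p ℕ.+ suc p) ≡ suc (3 ℕ.* p)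
          count = solve-∀

  positive zero    = record
    { vec = λ _ _ → 1ℤ ; norm = λ _ → refl ; orth = λ { {0F} {0F} 0≢0 → contradiction refl 0≢0 } }
  positive (suc m) = subst (SignedFamily _ 1ℤ) (count (pieces m)) (step {m} (positive m) (negative m))
    where count : ∀ p → suc p ℕ.+ (suc p ℕ.+ p) ≡ suc (suc (3 ℕ.* p))
          count = solve-∀

open import Defs
open import Data.Nat using (ℕ; suc; _*_; _^_; _∸_; _≤_)
open import Data.Product using (Σ; _×_)
open import Relation.Binary.PropositionalEquality using (_≡_)

open import Data.Product using (_,_)
open CoverNumber using (bc-value)
open Bicliques using (module BicliqueSpec)
open Partition using (pieces; pieces-formula; part; partition)
open InertiaBound using (partition-bound)
open Signature using (negative)

bp-value : ∀ m → bpIs (Words.G m) (pieces m)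
bp-value m = ((λ r → BicliqueSpec.biclique (part m r)) , partition m) ,
             partition-bound (Words.G m) (negative m)

-- The theorem; it holds for m = 0 as well (G 0 is a single vertex).
mainTheorem5 : ∀ (m : ℕ) → 1 ≤ m → Σ Graph λ G → Σ ℕ λ p →
    bcIs G m × bpIs G p × 2 * p ≡ 3 ^ m ∸ 1
mainTheorem5 m _ = Words.G m , pieces m , bc-value m , bp-value m , pieces-formula m
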